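{- Let $\Gamma$ be a $t$-walk-regular graph with odd-girth $2s+1$. Then the bipartite double of $\Gamma$ is $\min\{s,t\}$-walk-regular.
   Context: All graphs are finite and simple; $\Gamma$ is connected. For $t\geq0$, a graph is $t$-walk-regular if it has diameter at least $t$ and for every $\ell\geq 0$ the number of walks of length $\ell$ between vertices $x$ and $y$ depends only on $\mathrm{dist}(x,y)$ whenever $\mathrm{dist}(x,y)\leq t$. The odd-girth is the length of a shortest odd cycle. The bipartite double of $\Gamma$ has vertex set $\{x^+,x^-: x\in V(\Gamma)\}$, with $x^+$ adjacent to $y^-$ if and only if $x$ is adjacent to $y$ in $\Gamma$ (and no other edges). -}

module Defs where

open import Data.Nat using (ℕ; zero; suc; _+_; _*_; _≤_; _<_)
open import Data.Bool using (Bool; true; false; if_then_else_)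
open import Data.Fin using (Fin; zero; suc; splitAt; _≟_)
open import Data.Sum using (_⊎_; inj₁; inj₂)
open import Data.Product using (Σ; ∃; ∃-syntax; _×_; _,_)
open import Relation.Nullary using (¬_; does)
open import Relation.Binary.PropositionalEquality using (_≡_)
open import Function.Definitions using (Injective)

record Graph (n : ℕ) : Set where
  field
    adj   : Fin n → Fin n → Bool
    sym   : ∀ x y → adj x y ≡ adj y x
    loopless : ∀ x → adj x x ≡ false
open Graph public

sumFin : ∀ {n} → (Fin n → ℕ) → ℕ
sumFin {zero}  f = 0
sumFin {suc n} f = f zero + sumFin (λ i → f (suc i))

walks : ∀ {n} → Graph n → ℕ → Fin n → Fin n → ℕ
walks G zero    x y = if does (x ≟ y) then 1 else 0
walks G (suc ℓ) x y = sumFin (λ z → (if adj G x z then 1 else 0) * walks G ℓ z y)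

IsDist : ∀ {n} → Graph n → Fin n → Fin n → ℕ → Set
IsDist G x y d = (0 < walks G d x y) × (∀ k → k < d → walks G k x y ≡ 0)

Connected : ∀ {n} → Graph n → Set
Connected G = ∀ x y → ∃[ d ] IsDist G x y d

DiameterAtLeast : ∀ {n} → Graph n → ℕ → Set
DiameterAtLeast G t = ∃[ x ] ∃[ y ] ∃[ d ] (IsDist G x y d × t ≤ d)

WalkRegular : ∀ {n} → Graph n → ℕ → Set
WalkRegular {n} G t =
  DiameterAtLeast G t ×
  (∀ (x y x' y' : Fin n) (d : ℕ) → d ≤ t → IsDist G x y d → IsDist G x' y' d →
     ∀ ℓ → walks G ℓ x y ≡ walks G ℓ x' y')

-- a cycle of length k (k ≥ 3): k distinct vertices v₀,…,v_{k-1},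
-- consecutive ones adjacent and v_{k-1} adjacent to v₀
cyc-next : ∀ {k} → Fin k → Fin k
cyc-next {suc k} i with Data.Fin.toℕ i Data.Nat.<? k
... | Relation.Nullary.yes p = Data.Fin.fromℕ< (Data.Nat.s≤s p)
... | Relation.Nullary.no  _ = zero

IsCycle : ∀ {n} → Graph n → (k : ℕ) → (Fin k → Fin n) → Set
IsCycle G k v = (3 ≤ k) × Injective _≡_ _≡_ v × (∀ i → adj G (v i) (v (cyc-next i)) ≡ true)

OddGirth : ∀ {n} → Graph n → ℕ → Set
OddGirth G g =
  (∃[ m ] g ≡ suc (2 * m)) ×
  (∃[ v ] IsCycle G g v) ×
  (∀ k m v → k ≡ suc (2 * m) → IsCycle G k v → g ≤ k)

-- bipartite double: Fin (n + n), left copy = x⁺, right copy = x⁻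
bd-adj : ∀ {n} → Graph n → Fin (n + n) → Fin (n + n) → Bool
bd-adj {n} G i j with splitAt n i | splitAt n j
... | inj₁ x | inj₂ y = adj G x y
... | inj₂ x | inj₁ y = adj G x y
... | inj₁ _ | inj₁ _ = false
... | inj₂ _ | inj₂ _ = false

bd-sym : ∀ {n} (G : Graph n) x y → bd-adj G x y ≡ bd-adj G y x
bd-sym {n} G i j with splitAt n i | splitAt n j
... | inj₁ x | inj₂ y = sym G x y
... | inj₂ x | inj₁ y = sym G x y
... | inj₁ _ | inj₁ _ = Relation.Binary.PropositionalEquality.refl
... | inj₂ _ | inj₂ _ = Relation.Binary.PropositionalEquality.refl

bd-loop : ∀ {n} (G : Graph n) x → bd-adj G x x ≡ false
bd-loop {n} G i with splitAt n i
... | inj₁ _ = Relation.Binary.PropositionalEquality.refl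
... | inj₂ _ = Relation.Binary.PropositionalEquality.refl

BipartiteDouble : ∀ {n} → Graph n → Graph (n + n)
BipartiteDouble G = record { adj = bd-adj G ; sym = bd-sym G ; loopless = bd-loop G }

-- A walk of length ℓ from x⁺ (or x⁻) in the bipartite double is a walk of length ℓ from x in Γ,
-- ending on the side determined by the parity of ℓ; so walk counts in the double are those of Γ,
-- masked by a parity condition. If two vertices of the double are at distance D ≤ s, their
-- projections are at distance D in Γ: a shorter walk of the other parity would close up with a
-- walk of length D into an odd closed walk of length < 2s + 1, which contains an odd cycle shorter
-- than the odd girth. Hence walk-regularity of Γ transfers to the double up to distance min{s,t}.
module Submission where

open import Defs hiding (sym)
open import Data.Nat using (ℕ; zero; suc; _+_; _*_; _∸_; _⊓_; _≤_; _<_; z≤n; s≤s; _<?_; _≤?_; parity)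
open import Data.Nat.Properties hiding (_≟_)
open import Data.Nat.Induction using (<-rec)
open import Data.Parity.Base as ℙ using (Parity; 0ℙ; 1ℙ; _⁻¹)
open import Data.Parity.Properties using (_≟_; ⁻¹-involutive; +-homo-+)
open import Data.Bool using (Bool; true; false; if_then_else_)
open import Data.Fin using (Fin; toℕ; _↑ˡ_; _↑ʳ_; splitAt)
import Data.Fin as Fin
import Data.Fin.Properties as Fin
open import Data.Sum using (_⊎_; inj₁; inj₂)
open import Data.Product using (∃; ∃-syntax; _×_; _,_; proj₁)
open import Data.Empty using (⊥-elim)
open import Relation.Nullary using (¬_; Dec; yes; no; does; contradiction)
open import Relation.Nullary.Decidable using (_×-dec_; dec-true; dec-false; does-⇔)
open import Relation.Binary using (tri<; tri≈; tri>)
open import Function using (_∘_; case_of_; mk⇔)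
open import Relation.Binary.PropositionalEquality

p⁻¹+q≡p+q⁻¹ : ∀ p q → p ⁻¹ ℙ.+ q ≡ p ℙ.+ q ⁻¹
p⁻¹+q≡p+q⁻¹ 0ℙ q = refl
p⁻¹+q≡p+q⁻¹ 1ℙ q = sym (⁻¹-involutive q)

p≢q⇒p+q≡1ℙ : ∀ {p q} → p ≢ q → p ℙ.+ q ≡ 1ℙ
p≢q⇒p+q≡1ℙ {0ℙ} {0ℙ} p≢q = contradiction refl p≢q
p≢q⇒p+q≡1ℙ {0ℙ} {1ℙ} _   = refl
p≢q⇒p+q≡1ℙ {1ℙ} {0ℙ} _   = refl
p≢q⇒p+q≡1ℙ {1ℙ} {1ℙ} p≢q = contradiction refl p≢q

p+q≡1ℙ⇒p≡1ℙ⊎q≡1ℙ : ∀ p q → p ℙ.+ q ≡ 1ℙ → p ≡ 1ℙ ⊎ q ≡ 1ℙ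
p+q≡1ℙ⇒p≡1ℙ⊎q≡1ℙ 1ℙ q _ = inj₁ refl
p+q≡1ℙ⇒p≡1ℙ⊎q≡1ℙ 0ℙ q e = inj₂ e

does-+-cancelˡ : ∀ p q r → does (p ℙ.+ q ≟ p ℙ.+ r) ≡ does (q ≟ r)
does-+-cancelˡ 0ℙ q r = refl
does-+-cancelˡ 1ℙ 0ℙ 0ℙ = refl
does-+-cancelˡ 1ℙ 0ℙ 1ℙ = refl
does-+-cancelˡ 1ℙ 1ℙ 0ℙ = refl
does-+-cancelˡ 1ℙ 1ℙ 1ℙ = refl

parity≡1ℙ⇒odd : ∀ k → parity k ≡ 1ℙ → ∃[ m ] k ≡ suc (2 * m)
parity≡1ℙ⇒odd 1 _ = 0 , refl
parity≡1ℙ⇒odd (suc (suc k)) odd with parity≡1ℙ⇒odd k odd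
... | m , refl = suc m , cong suc (sym (*-suc 2 m))

parity≡1ℙ⇒3≤ : ∀ k → parity k ≡ 1ℙ → k ≢ 1 → 3 ≤ k
parity≡1ℙ⇒3≤ 1 _ k≢1 = contradiction refl k≢1
parity≡1ℙ⇒3≤ (suc (suc (suc k))) _ _ = s≤s (s≤s (s≤s z≤n))

sumFin-cong : ∀ {n} {f g : Fin n → ℕ} → (∀ i → f i ≡ g i) → sumFin f ≡ sumFin g
sumFin-cong {zero}  f≗g = refl
sumFin-cong {suc n} f≗g = cong₂ _+_ (f≗g Fin.zero) (sumFin-cong (f≗g ∘ Fin.suc))

sumFin-zero : ∀ {n} (f : Fin n → ℕ) → (∀ i → f i ≡ 0) → sumFin f ≡ 0
sumFin-zero {zero}  f f≗0 = refl
sumFin-zero {suc n} f f≗0 rewrite f≗0 Fin.zero = sumFin-zero (f ∘ Fin.suc) (f≗0 ∘ Fin.suc)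

sumFin-++ : ∀ m {n} (f : Fin (m + n) → ℕ) →
  sumFin f ≡ sumFin (λ i → f (i ↑ˡ n)) + sumFin (λ i → f (m ↑ʳ i))
sumFin-++ zero    f = refl
sumFin-++ (suc m) f =
  trans (cong (f Fin.zero +_) (sumFin-++ m (f ∘ Fin.suc))) (sym (+-assoc (f Fin.zero) _ _))

sumFin-positive : ∀ {n} (f : Fin n → ℕ) → 0 < sumFin f → ∃[ i ] 0 < f i
sumFin-positive {suc n} f pos with f Fin.zero in e
... | suc _ = Fin.zero , subst (0 <_) (sym e) (s≤s z≤n)
... | zero with sumFin-positive (f ∘ Fin.suc) pos
...   | i , fi>0 = Fin.suc i , fi>0

sumFin-*-if : ∀ {n} c (f g : Fin n → ℕ) →
  sumFin (λ i → f i * (if c then g i else 0)) ≡ (if c then sumFin (λ i → f i * g i) else 0)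
sumFin-*-if true  f g = refl
sumFin-*-if false f g = sumFin-zero _ (λ i → *-zeroʳ (f i))

if-positive : ∀ {P : Set} (P? : Dec P) w → 0 < (if does P? then w else 0) → P × 0 < w
if-positive (yes p) w w>0 = p , w>0

module Walks {n : ℕ} (G : Graph n) where

  Adjacent : Fin n → Fin n → Set
  Adjacent x y = adj G x y ≡ true

  -- A walk of length L is the sequence f 0, …, f L; the values of f beyond L are irrelevant.
  IsWalk : (ℕ → Fin n) → ℕ → Set
  IsWalk f L = ∀ m → m < L → Adjacent (f m) (f (suc m))

  walks-positive⇒walk : ∀ ℓ x y → 0 < walks G ℓ x y →
    ∃[ f ] f 0 ≡ x × f ℓ ≡ y × IsWalk f ℓ
  walks-positive⇒walk zero x y pos with x Fin.≟ y
  ... | yes x≡y = (λ _ → x) , refl , x≡y , λ _ ()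
  walks-positive⇒walk (suc ℓ) x y pos with sumFin-positive _ pos
  ... | z , term>0 with adj G x z in x~z
  ...   | true with walks-positive⇒walk ℓ z y (subst (0 <_) (+-identityʳ _) term>0)
  ...     | f , f0≡z , fℓ≡y , f-walk = cons , refl , fℓ≡y , cons-walk
    where
    cons : ℕ → Fin n
    cons zero    = x
    cons (suc m) = f m
    cons-walk : IsWalk cons (suc ℓ)
    cons-walk zero    _         = subst (Adjacent x) (sym f0≡z) x~z
    cons-walk (suc m) (s≤s m<ℓ) = f-walk m m<ℓ

  shift : ℕ → (ℕ → Fin n) → ℕ → Fin n
  shift i f m = f (i + m)

  shift-walk : ∀ {f L} i e → i + e ≤ L → IsWalk f L → IsWalk (shift i f) e
  shift-walk {f} i e i+e≤L f-walk m m<e =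
    subst (Adjacent (f (i + m)) ∘ f) (sym (+-suc i m))
      (f-walk (i + m) (<-≤-trans (+-monoʳ-< i m<e) i+e≤L))

  reverse : ℕ → (ℕ → Fin n) → ℕ → Fin n
  reverse L f m = f (L ∸ m)

  reverse-walk : ∀ {f} L → IsWalk f L → IsWalk (reverse L f) L
  reverse-walk {f} L f-walk m m<L =
    subst (λ k → Adjacent (f k) (f (L ∸ suc m))) 1+L∸1+m≡L∸m
      (trans (Graph.sym G _ _) (f-walk (L ∸ suc m) (∸-monoʳ-< {L} {suc m} {0} (s≤s z≤n) m<L)))
    where
    1+L∸1+m≡L∸m : suc (L ∸ suc m) ≡ L ∸ m
    1+L∸1+m≡L∸m = sym (+-∸-assoc 1 m<L)

  append : ℕ → (ℕ → Fin n) → (ℕ → Fin n) → ℕ → Fin n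
  append d f g m with m ≤? d
  ... | yes _ = f m
  ... | no  _ = g (m ∸ d)

  module _ {d : ℕ} {f g : ℕ → Fin n} where

    append-≤ : ∀ {m} → m ≤ d → append d f g m ≡ f m
    append-≤ {m} m≤d with m ≤? d
    ... | yes _   = refl
    ... | no  m≰d = contradiction m≤d m≰d

    append-≥ : ∀ {m} → f d ≡ g 0 → d ≤ m → append d f g m ≡ g (m ∸ d)
    append-≥ {m} fd≡g0 d≤m with m ≤? d
    ... | no  _   = refl
    ... | yes m≤d rewrite ≤-antisym m≤d d≤m = trans fd≡g0 (cong g (sym (n∸n≡0 d)))

    append-walk : ∀ {e} → IsWalk f d → IsWalk g e → f d ≡ g 0 → IsWalk (append d f g) (d + e)
    append-walk {e} f-walk g-walk fd≡g0 m m<d+e with <-≤-connex m d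
    ... | inj₁ m<d =
      subst₂ Adjacent (sym (append-≤ (<⇒≤ m<d))) (sym (append-≤ m<d)) (f-walk m m<d)
    ... | inj₂ d≤m =
      subst₂ Adjacent (sym (append-≥ fd≡g0 d≤m))
        (sym (trans (append-≥ fd≡g0 (m≤n⇒m≤1+n d≤m)) (cong g (+-∸-assoc 1 d≤m))))
        (g-walk (m ∸ d) (+-cancelˡ-< d (m ∸ d) e (subst (_< d + e) (sym (m+[n∸m]≡n d≤m)) m<d+e)))

  prefix-walk : ∀ {f L} e → e ≤ L → IsWalk f L → IsWalk f e
  prefix-walk e e≤L f-walk m m<e = f-walk m (<-≤-trans m<e e≤L)

  IsClosedWalk : (ℕ → Fin n) → ℕ → Set
  IsClosedWalk f L = IsWalk f L × f L ≡ f 0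

  Repeats : (ℕ → Fin n) → ℕ → Set
  Repeats f L = ∃ λ (i : Fin L) → ∃ λ (j : Fin L) → toℕ i < toℕ j × f (toℕ i) ≡ f (toℕ j)

  repeats? : ∀ f L → Dec (Repeats f L)
  repeats? f L =
    Fin.any? λ i → Fin.any? λ j → (toℕ i <? toℕ j) ×-dec (f (toℕ i) Fin.≟ f (toℕ j))

  cyc-next-spec : ∀ {k} (i : Fin (suc k)) →
    (toℕ i < k × toℕ (cyc-next i) ≡ suc (toℕ i)) ⊎ (toℕ i ≡ k × cyc-next i ≡ Fin.zero)
  cyc-next-spec {k} i with toℕ i <? k
  ... | yes i<k = inj₁ (i<k , Fin.toℕ-fromℕ< (s≤s i<k))
  ... | no  i≮k = inj₂ (≤-antisym (Fin.toℕ≤pred[n] i) (≮⇒≥ i≮k) , refl)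

  closedWalk⇒cycle : ∀ {f} L → 3 ≤ L → IsClosedWalk f L → ¬ Repeats f L → IsCycle G L (f ∘ toℕ)
  closedWalk⇒cycle {f} (suc k) 3≤L (f-walk , closed) no-repeats = 3≤L , injective , adjacent
    where
    injective : ∀ {i j} → f (toℕ i) ≡ f (toℕ j) → i ≡ j
    injective {i} {j} fi≡fj with <-cmp (toℕ i) (toℕ j)
    ... | tri< i<j _ _ = contradiction (i , j , i<j , fi≡fj) no-repeats
    ... | tri≈ _ i≡j _ = Fin.toℕ-injective i≡j
    ... | tri> _ _ j<i = contradiction (j , i , j<i , sym fi≡fj) no-repeats
    adjacent : ∀ i → Adjacent (f (toℕ i)) (f (toℕ (cyc-next i)))
    adjacent i with cyc-next-spec i
    ... | inj₁ (_ , next≡1+i) =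
      subst (Adjacent (f (toℕ i)) ∘ f) (sym next≡1+i) (f-walk (toℕ i) (Fin.toℕ<n i))
    ... | inj₂ (i≡k , next≡0) rewrite next≡0 =
      subst (Adjacent (f (toℕ i))) (trans (cong (f ∘ suc) i≡k) closed) (f-walk (toℕ i) (Fin.toℕ<n i))

  excursion-closedWalk : ∀ {f L i j} → IsWalk f L → i ≤ j → j ≤ L → f i ≡ f j →
    IsClosedWalk (shift i f) (j ∸ i)
  excursion-closedWalk {f} {L} {i} {j} f-walk i≤j j≤L fi≡fj =
    shift-walk i (j ∸ i) (subst (_≤ L) (sym (m+[n∸m]≡n i≤j)) j≤L) f-walk ,
    trans (cong f (m+[n∸m]≡n i≤j)) (trans (sym fi≡fj) (cong f (sym (+-identityʳ i))))

  shortcut-closedWalk : ∀ {f L i j} → IsClosedWalk f L → i ≤ j → j ≤ L → f i ≡ f j →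
    IsClosedWalk (append i f (shift j f)) (i + (L ∸ j))
  shortcut-closedWalk {f} {L} {i} {j} (f-walk , closed) i≤j j≤L fi≡fj = shortcut-walk , shortcut-closed
    where
    fi≡fj+0 : f i ≡ shift j f 0
    fi≡fj+0 = trans fi≡fj (cong f (sym (+-identityʳ j)))
    shortcut = append i f (shift j f)
    shortcut-walk : IsWalk shortcut (i + (L ∸ j))
    shortcut-walk = append-walk (prefix-walk i (≤-trans i≤j j≤L) f-walk)
                      (shift-walk j (L ∸ j) (≤-reflexive (m+[n∸m]≡n j≤L)) f-walk) fi≡fj+0
    shortcut-closed : shortcut (i + (L ∸ j)) ≡ shortcut 0
    shortcut-closed = begin
      shortcut (i + (L ∸ j))      ≡⟨ append-≥ {i} {f} {shift j f} fi≡fj+0 (m≤m+n i (L ∸ j)) ⟩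
      f (j + (i + (L ∸ j) ∸ i))   ≡⟨ cong (f ∘ (j +_)) (m+n∸m≡n i (L ∸ j)) ⟩
      f (j + (L ∸ j))             ≡⟨ cong f (m+[n∸m]≡n j≤L) ⟩
      f L                         ≡⟨ closed ⟩
      f 0                         ≡⟨ sym (append-≤ {i} {f} {shift j f} z≤n) ⟩
      shortcut 0                  ∎
      where open ≡-Reasoning

  -- The excursion and the shortcut at a repeated vertex have lengths adding up to L,
  -- so one of them is odd when L is.
  repeats⇒shorter-odd-closedWalk : ∀ {f L} → parity L ≡ 1ℙ → IsClosedWalk f L → Repeats f L →
    ∃[ L' ] ∃[ f' ] L' < L × parity L' ≡ 1ℙ × IsClosedWalk f' L'
  repeats⇒shorter-odd-closedWalk {f} {L} odd closed-walk (i′ , j′ , i<j , fi≡fj) =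
    shorter (p+q≡1ℙ⇒p≡1ℙ⊎q≡1ℙ (parity (j ∸ i)) (parity (i + (L ∸ j))) parity-split)
    where
    i = toℕ i′
    j = toℕ j′
    j<L : j < L
    j<L = Fin.toℕ<n j′
    parity-split : parity (j ∸ i) ℙ.+ parity (i + (L ∸ j)) ≡ 1ℙ
    parity-split = begin
      parity (j ∸ i) ℙ.+ parity (i + (L ∸ j)) ≡⟨ sym (+-homo-+ (j ∸ i) (i + (L ∸ j))) ⟩
      parity ((j ∸ i) + (i + (L ∸ j)))        ≡⟨ cong parity (sym (+-assoc (j ∸ i) i (L ∸ j))) ⟩
      parity ((j ∸ i) + i + (L ∸ j))          ≡⟨ cong (λ k → parity (k + (L ∸ j))) (m∸n+n≡m (<⇒≤ i<j)) ⟩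
      parity (j + (L ∸ j))                    ≡⟨ cong parity (m+[n∸m]≡n (<⇒≤ j<L)) ⟩
      parity L                                ≡⟨ odd ⟩
      1ℙ                                      ∎
      where open ≡-Reasoning
    shorter : parity (j ∸ i) ≡ 1ℙ ⊎ parity (i + (L ∸ j)) ≡ 1ℙ →
      ∃[ L' ] ∃[ f' ] L' < L × parity L' ≡ 1ℙ × IsClosedWalk f' L'
    shorter (inj₁ excursion-odd) =
      j ∸ i , shift i f , ≤-<-trans (m∸n≤m j i) j<L , excursion-odd ,
      excursion-closedWalk (proj₁ closed-walk) (<⇒≤ i<j) (<⇒≤ j<L) fi≡fj
    shorter (inj₂ shortcut-odd) =
      i + (L ∸ j) , append i f (shift j f) ,
      subst (i + (L ∸ j) <_) (m+[n∸m]≡n (<⇒≤ j<L)) (+-monoˡ-< (L ∸ j) i<j) , shortcut-odd ,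
      shortcut-closedWalk closed-walk (<⇒≤ i<j) (<⇒≤ j<L) fi≡fj

  closedWalk-length≢1 : ∀ {f L} → IsClosedWalk f L → L ≢ 1
  closedWalk-length≢1 {f} (f-walk , closed) refl =
    case trans (sym (subst (Adjacent (f 0)) closed (f-walk 0 (s≤s z≤n)))) (loopless G (f 0)) of λ ()

  oddGirth≤oddClosedWalk : ∀ {g} → OddGirth G g → ∀ L {f} → parity L ≡ 1ℙ → IsClosedWalk f L → g ≤ L
  oddGirth≤oddClosedWalk {g} (_ , _ , g≤oddCycle) = <-rec P bound
    where
    P : ℕ → Set
    P L = ∀ {f} → parity L ≡ 1ℙ → IsClosedWalk f L → g ≤ L
    bound : ∀ L → (∀ {L'} → L' < L → P L') → P L
    bound L shorter {f} odd closed-walk with repeats? f L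
    ... | yes repeats =
      let L' , _ , L'<L , odd' , closed-walk' = repeats⇒shorter-odd-closedWalk odd closed-walk repeats
      in ≤-trans (shorter L'<L odd' closed-walk') (<⇒≤ L'<L)
    ... | no no-repeats =
      let m , L≡1+2m = parity≡1ℙ⇒odd L odd
          3≤L = parity≡1ℙ⇒3≤ L odd (closedWalk-length≢1 closed-walk)
      in g≤oddCycle L m (f ∘ toℕ) L≡1+2m (closedWalk⇒cycle L 3≤L closed-walk no-repeats)

  oddGirth≤walks-of-distinct-parity : ∀ {g} → OddGirth G g → ∀ {x y} d D →
    0 < walks G d x y → 0 < walks G D x y → parity d ≢ parity D → g ≤ d + D
  oddGirth≤walks-of-distinct-parity oddGirth {x} {y} d D d-walks>0 D-walks>0 parity-d≢D
    with walks-positive⇒walk d x y d-walks>0 | walks-positive⇒walk D x y D-walks>0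
  ... | p , p0≡x , pd≡y , p-walk | q , q0≡x , qD≡y , q-walk =
    oddGirth≤oddClosedWalk oddGirth (d + D) odd (closed-walk , closed-end)
    where
    back = reverse D q
    pd≡back0 : p d ≡ back 0
    pd≡back0 = trans pd≡y (sym qD≡y)
    closed = append d p back
    odd : parity (d + D) ≡ 1ℙ
    odd = trans (+-homo-+ d D) (p≢q⇒p+q≡1ℙ parity-d≢D)
    closed-walk : IsWalk closed (d + D)
    closed-walk = append-walk p-walk (reverse-walk D q-walk) pd≡back0
    closed-end : closed (d + D) ≡ closed 0
    closed-end = begin
      closed (d + D)        ≡⟨ append-≥ {d} {p} {back} pd≡back0 (m≤m+n d D) ⟩
      q (D ∸ (d + D ∸ d))   ≡⟨ cong (λ k → q (D ∸ k)) (m+n∸m≡n d D) ⟩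
      q (D ∸ D)             ≡⟨ cong q (n∸n≡0 D) ⟩
      q 0                   ≡⟨ trans q0≡x (sym p0≡x) ⟩
      p 0                   ≡⟨ sym (append-≤ {d} {p} {back} z≤n) ⟩
      closed 0              ∎
      where open ≡-Reasoning

  IsDist-minimal : ∀ {x y d k} → IsDist G x y d → 0 < walks G k x y → d ≤ k
  IsDist-minimal {k = k} (_ , below-d) k-walks>0 =
    ≮⇒≥ (λ k<d → <-irrefl (sym (below-d k k<d)) k-walks>0)

  IsDist-unique : ∀ {x y d D} → IsDist G x y d → IsDist G x y D → d ≡ D
  IsDist-unique dist-d dist-D =
    ≤-antisym (IsDist-minimal dist-d (proj₁ dist-D)) (IsDist-minimal dist-D (proj₁ dist-d))

module BipartiteDoubleWalks {n : ℕ} (Γ : Graph n) where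

  open Walks using (IsDist-minimal; IsDist-unique; oddGirth≤walks-of-distinct-parity)

  BD : Graph (n + n)
  BD = BipartiteDouble Γ

  side : Parity → Fin n → Fin (n + n)
  side 0ℙ x = x ↑ˡ n
  side 1ℙ x = n ↑ʳ x

  side-surjective : ∀ u → ∃[ p ] ∃[ x ] u ≡ side p x
  side-surjective u with splitAt n u in split
  ... | inj₁ x = 0ℙ , x , trans (sym (Fin.join-splitAt n n u)) (cong (Fin.join n n) split)
  ... | inj₂ x = 1ℙ , x , trans (sym (Fin.join-splitAt n n u)) (cong (Fin.join n n) split)

  ↑ˡ≢↑ʳ : ∀ x y → x ↑ˡ n ≢ n ↑ʳ y
  ↑ˡ≢↑ʳ x y eq =
    case trans (sym (Fin.splitAt-↑ˡ n x n)) (trans (cong (splitAt n) eq) (Fin.splitAt-↑ʳ n n y)) of λ ()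

  bd-adj-same : ∀ p x z → bd-adj Γ (side p x) (side p z) ≡ false
  bd-adj-same 0ℙ x z rewrite Fin.splitAt-↑ˡ n x n | Fin.splitAt-↑ˡ n z n = refl
  bd-adj-same 1ℙ x z rewrite Fin.splitAt-↑ʳ n n x | Fin.splitAt-↑ʳ n n z = refl

  bd-adj-opposite : ∀ p x z → bd-adj Γ (side p x) (side (p ⁻¹) z) ≡ adj Γ x z
  bd-adj-opposite 0ℙ x z rewrite Fin.splitAt-↑ˡ n x n | Fin.splitAt-↑ʳ n n z = refl
  bd-adj-opposite 1ℙ x z rewrite Fin.splitAt-↑ʳ n n x | Fin.splitAt-↑ˡ n z n = refl

  sumFin-both-sides : ∀ p (f : Parity → Fin n → ℕ) → (∀ z → f p z ≡ 0) →
    sumFin (f 0ℙ) + sumFin (f 1ℙ) ≡ sumFin (f (p ⁻¹))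
  sumFin-both-sides 0ℙ f fp≗0 = cong (_+ sumFin (f 1ℙ)) (sumFin-zero (f 0ℙ) fp≗0)
  sumFin-both-sides 1ℙ f fp≗0 = trans (cong (sumFin (f 0ℙ) +_) (sumFin-zero (f 1ℙ) fp≗0)) (+-identityʳ _)

  walks-side : ∀ ℓ p q x y →
    walks BD ℓ (side p x) (side q y) ≡ (if does (p ℙ.+ parity ℓ ≟ q) then walks Γ ℓ x y else 0)
  walks-side zero 0ℙ 0ℙ x y =
    cong (if_then 1 else 0)
      (does-⇔ (mk⇔ (Fin.↑ˡ-injective n x y) (cong (_↑ˡ n))) (x ↑ˡ n Fin.≟ y ↑ˡ n) (x Fin.≟ y))
  walks-side zero 1ℙ 1ℙ x y =
    cong (if_then 1 else 0)
      (does-⇔ (mk⇔ (Fin.↑ʳ-injective n x y) (cong (n ↑ʳ_))) (n ↑ʳ x Fin.≟ n ↑ʳ y) (x Fin.≟ y))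
  walks-side zero 0ℙ 1ℙ x y = cong (if_then 1 else 0) (dec-false (x ↑ˡ n Fin.≟ n ↑ʳ y) (↑ˡ≢↑ʳ x y))
  walks-side zero 1ℙ 0ℙ x y = cong (if_then 1 else 0) (dec-false (n ↑ʳ x Fin.≟ y ↑ˡ n) (↑ˡ≢↑ʳ y x ∘ sym))
  walks-side (suc ℓ) p q x y = begin
    walks BD (suc ℓ) (side p x) (side q y)
      ≡⟨ sumFin-++ n _ ⟩
    sumFin (step 0ℙ) + sumFin (step 1ℙ)
      ≡⟨ sumFin-both-sides p step same-step ⟩
    sumFin (step (p ⁻¹))
      ≡⟨ sumFin-cong opposite-step ⟩
    sumFin (λ z → ⟦ adj Γ x z ⟧ * (if does (p ⁻¹ ℙ.+ parity ℓ ≟ q) then walks Γ ℓ z y else 0))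
      ≡⟨ sumFin-*-if _ (λ z → ⟦ adj Γ x z ⟧) (λ z → walks Γ ℓ z y) ⟩
    (if does (p ⁻¹ ℙ.+ parity ℓ ≟ q) then walks Γ (suc ℓ) x y else 0)
      ≡⟨ cong (λ r → if does (r ≟ q) then walks Γ (suc ℓ) x y else 0) parity-shift ⟩
    (if does (p ℙ.+ parity (suc ℓ) ≟ q) then walks Γ (suc ℓ) x y else 0)
      ∎
    where
    open ≡-Reasoning
    ⟦_⟧ : Bool → ℕ
    ⟦ b ⟧ = if b then 1 else 0
    step : Parity → Fin n → ℕ
    step r z = ⟦ bd-adj Γ (side p x) (side r z) ⟧ * walks BD ℓ (side r z) (side q y)
    same-step : ∀ z → step p z ≡ 0
    same-step z rewrite bd-adj-same p x z = refl
    opposite-step : ∀ z →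
      step (p ⁻¹) z ≡ ⟦ adj Γ x z ⟧ * (if does (p ⁻¹ ℙ.+ parity ℓ ≟ q) then walks Γ ℓ z y else 0)
    opposite-step z rewrite bd-adj-opposite p x z | walks-side ℓ (p ⁻¹) q z y = refl
    parity-shift : p ⁻¹ ℙ.+ parity ℓ ≡ p ℙ.+ parity (suc ℓ)
    parity-shift = trans (p⁻¹+q≡p+q⁻¹ p (parity ℓ)) (cong (p ℙ.+_) (sym (+-homo-+ 1 ℓ)))

  walks-side-offset : ∀ ℓ p r x y →
    walks BD ℓ (side p x) (side (p ℙ.+ r) y) ≡ (if does (parity ℓ ≟ r) then walks Γ ℓ x y else 0)
  walks-side-offset ℓ p r x y =
    trans (walks-side ℓ p (p ℙ.+ r) x y)
          (cong (if_then walks Γ ℓ x y else 0) (does-+-cancelˡ p (parity ℓ) r))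

  IsDist-side : ∀ {x y d} p → IsDist Γ x y d → IsDist BD (side p x) (side (p ℙ.+ parity d) y) d
  IsDist-side {x} {y} {d} p (d-walks>0 , below-d) = d-walks-BD>0 , below-d-BD
    where
    d-walks-BD>0 : 0 < walks BD d (side p x) (side (p ℙ.+ parity d) y)
    d-walks-BD>0 rewrite walks-side-offset d p (parity d) x y | dec-true (parity d ≟ parity d) refl =
      d-walks>0
    below-d-BD : ∀ k → k < d → walks BD k (side p x) (side (p ℙ.+ parity d) y) ≡ 0
    below-d-BD k k<d rewrite walks-side-offset k p (parity d) x y | below-d k k<d
      with does (parity k ≟ parity d)
    ... | true  = refl
    ... | false = refl

  module _ {s : ℕ} (connected : Connected Γ) (oddGirth : OddGirth Γ (2 * s + 1)) where

    -- Within distance s no odd cycle is available, so a shortest walk in the double has the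
    -- length of a shortest walk in Γ, and its parity fixes the sides of the endpoints.
    IsDist-side-reflect : ∀ {p q x y D} → D ≤ s → IsDist BD (side p x) (side q y) D →
      IsDist Γ x y D × q ≡ p ℙ.+ parity D
    IsDist-side-reflect {p} {q} {x} {y} {D} D≤s dist-BD
      with if-positive (p ℙ.+ parity D ≟ q) _ (subst (0 <_) (walks-side D p q x y) (proj₁ dist-BD))
         | connected x y
    ... | q≡p+D , D-walks>0 | d , dist-d with parity d ≟ parity D
    ...   | yes same-parity = subst (IsDist Γ x y) d≡D dist-d , sym q≡p+D
      where
      d≡D : d ≡ D
      d≡D = IsDist-unique BD
        (subst (λ r → IsDist BD (side p x) (side r y) d) (trans (cong (p ℙ.+_) same-parity) q≡p+D)
          (IsDist-side p dist-d))
        dist-BD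
    ...   | no parity-differs = ⊥-elim (n≮n (2 * s) (subst (_≤ 2 * s) (+-comm (2 * s) 1) girth≤2s))
      where
      d≤D : d ≤ D
      d≤D = IsDist-minimal Γ dist-d D-walks>0
      girth≤2s : 2 * s + 1 ≤ 2 * s
      girth≤2s = begin
        2 * s + 1
          ≤⟨ oddGirth≤walks-of-distinct-parity Γ oddGirth d D (proj₁ dist-d) D-walks>0 parity-differs ⟩
        d + D       ≤⟨ +-mono-≤ (≤-trans d≤D D≤s) (≤-trans D≤s (m≤m+n s 0)) ⟩
        s + (s + 0) ∎
        where open ≤-Reasoning

    walks-at-distance : ∀ {u v D} → D ≤ s → IsDist BD u v D →
      ∃[ x ] ∃[ y ] IsDist Γ x y D ×
        (∀ ℓ → walks BD ℓ u v ≡ (if does (parity ℓ ≟ parity D) then walks Γ ℓ x y else 0))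
    walks-at-distance {u} {v} {D} D≤s dist-uv with side-surjective u | side-surjective v
    ... | p , x , refl | q , y , refl with IsDist-side-reflect {p} {q} D≤s dist-uv
    ...   | dist-xy , refl = x , y , dist-xy , λ ℓ → walks-side-offset ℓ p (parity D) x y

proposition3p1 : ∀ {n : ℕ} (Γ : Graph n) (t s : ℕ) →
    Connected Γ → WalkRegular Γ t → OddGirth Γ (2 * s + 1) →
    WalkRegular (BipartiteDouble Γ) (s ⊓ t)
proposition3p1 {n} Γ t s connected (diameter≥t , walk-regular) oddGirth =
  diameter-BD≥s⊓t diameter≥t , walk-regular-BD
  where
  open BipartiteDoubleWalks Γ

  diameter-BD≥s⊓t : DiameterAtLeast Γ t → DiameterAtLeast BD (s ⊓ t)
  diameter-BD≥s⊓t (x , y , d , dist-xy , t≤d) =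
    side 0ℙ x , side (parity d) y , d , IsDist-side 0ℙ dist-xy , ≤-trans (m⊓n≤n s t) t≤d

  walk-regular-BD : ∀ (u v u' v' : Fin (n + n)) (D : ℕ) → D ≤ s ⊓ t →
    IsDist BD u v D → IsDist BD u' v' D → ∀ ℓ → walks BD ℓ u v ≡ walks BD ℓ u' v'
  walk-regular-BD u v u' v' D D≤s⊓t dist-uv dist-u'v' ℓ
    with walks-at-distance connected oddGirth (≤-trans D≤s⊓t (m⊓n≤m s t)) dist-uv
       | walks-at-distance connected oddGirth (≤-trans D≤s⊓t (m⊓n≤m s t)) dist-u'v'
  ... | x , y , dist-xy , walks-uv | x' , y' , dist-x'y' , walks-u'v' = begin
    walks BD ℓ u v                                                  ≡⟨ walks-uv ℓ ⟩
    (if does (parity ℓ ≟ parity D) then walks Γ ℓ x y else 0)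
      ≡⟨ cong (if does (parity ℓ ≟ parity D) then_else 0) Γ-regular ⟩
    (if does (parity ℓ ≟ parity D) then walks Γ ℓ x' y' else 0)     ≡⟨ walks-u'v' ℓ ⟨
    walks BD ℓ u' v'                                                ∎
    where
    open ≡-Reasoning
    Γ-regular : walks Γ ℓ x y ≡ walks Γ ℓ x' y'
    Γ-regular = walk-regular x y x' y' D (≤-trans D≤s⊓t (m⊓n≤n s t)) dist-xy dist-x'y' ℓ
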